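{- Let $a,b,c$ be positive integers such that $\gcd(a,b,c)=1$ and $b+c\nmid a$. Then $C_{b+c}(a,b)$ is a Heuberger circulant graph. Moreover, let $y_{11},y_{12},y_{21},y_{22},y_{31},y_{32}$ be integers, and let \[M_X=\begin{pmatrix} y_{11} & y_{12}\\ y_{21} & y_{22}\\ y_{31} & y_{32}\end{pmatrix},\qquad M_Y=\begin{pmatrix} y_{11} & y_{12}\\ y_{21}-y_{31} & y_{22}-y_{32}\end{pmatrix},\] and let $X=M_X^{\mathrm{SACG}}$ and $Y=M_Y^{\mathrm{SACG}}$. Let $\phi_X\colon\mathbb{Z}^3\to\mathbb{Z}$ be the homomorphism with $e_1\mapsto a$, $e_2\mapsto b$, $e_3\mapsto c$, and suppose that $\phi_X$ induces an isomorphism between $X$ and the Zhu $\{a,b,c\}$ graph $\mathrm{Cay}(\mathbb{Z},\{\pm a,\pm b,\pm c\})$ (i.e. the kernel of $\phi_X$ is the $\mathbb{Z}$-span of the columns of $M_X$). Then the homomorphism $\phi_Y\colon\mathbb{Z}^2\to\mathbb{Z}_{b+c}$ with $e_1\mapsto a$, $e_2\mapsto b$ induces an isomorphism between $Y$ and $C_{b+c}(a,b)$. Furthermore, let $\tau_1\colon\mathbb{Z}^3\to\mathbb{Z}^2$ be the homomorphism with $e_1\mapsto e_1$, $e_2\mapsto e_2$, $e_3\mapsto -e_2$, and let $\tau_2\colon\mathbb{Z}\to\mathbb{Z}_{b+c}$ be reduction modulo $b+c$. Then $\tau_1$ induces a graph homomorphism $X\to Y$, $\tau_2$ induces a graph homomorphism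 $\mathrm{Cay}(\mathbb{Z},\{\pm a,\pm b,\pm c\})\to C_{b+c}(a,b)$, and the resulting square commutes: $\tau_2\circ\phi_X=\phi_Y\circ\tau_1$.
   Context: For an integer matrix $M$ with $m$ rows, let $H\le\mathbb{Z}^m$ be the subgroup generated by the columns of $M$; the standardized abelian Cayley graph $M^{\mathrm{SACG}}$ is the Cayley graph $\mathrm{Cay}(\mathbb{Z}^m/H,\{\pm e_1+H,\dots,\pm e_m+H\})$, where $e_1,\dots,e_m$ are the standard basis vectors. For integers $n\ge 1$ and $a,b$, $C_n(a,b)$ denotes the circulant graph $\mathrm{Cay}(\mathbb{Z}_n,\{\pm a,\pm b\})$; it is called a Heuberger circulant when $\gcd(a,b,n)=1$ and $a\not\equiv 0$, $b\not\equiv 0 \pmod n$. For positive integers $a,b,c$ with $\gcd(a,b,c)=1$, the Zhu $\{a,b,c\}$ graph is $\mathrm{Cay}(\mathbb{Z},\{\pm a,\pm b,\pm c\})$, i.e. the graph on $\mathbb{Z}$ where $x\sim y$ iff $|x-y|\in\{a,b,c\}$. A homomorphism of groups is said to induce a graph map between Cayley graphs when the induced map on the relevant quotient groups sends adjacent vertices to adjacent vertices (isomorphism: bijective with inverse also a graph homomorphism). -}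

module Defs where

open import Data.Nat as ℕ using (ℕ; zero; suc)
open import Data.Fin using (Fin; zero; suc)
open import Data.Integer using (ℤ; +_; -_; _+_; _*_; _-_; 0ℤ; 1ℤ)
open import Data.Integer.Divisibility using (_∣_)
open import Data.Integer.GCD using (gcd)
open import Data.Product using (Σ; ∃; ∃-syntax; _×_; _,_)
open import Data.Sum using (_⊎_)
open import Relation.Nullary using (¬_)
open import Relation.Binary.PropositionalEquality using (_≡_)

Vecℤ : ℕ → Set
Vecℤ m = Fin m → ℤ

Matrix : ℕ → ℕ → Set
Matrix m k = Fin m → Fin k → ℤ

∑ : ∀ {k} → (Fin k → ℤ) → ℤ
∑ {zero}  f = 0ℤ
∑ {suc k} f = f zero + ∑ (λ j → f (suc j))

e : ∀ {m} → Fin m → Vecℤ m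
e zero    zero    = 1ℤ
e zero    (suc j) = 0ℤ
e (suc i) zero    = 0ℤ
e (suc i) (suc j) = e i j

InSpan : ∀ {m k} → Matrix m k → Vecℤ m → Set
InSpan {m} {k} M v = Σ (Fin k → ℤ) λ c → (∀ (i : Fin m) → v i ≡ ∑ (λ (j : Fin k) → M i j * c j))

-- A Cayley graph Cay(G/H, S+H) on a quotient of an abelian group G:
-- V is the carrier of G, H the subgroup (as predicate), S the connection set
-- (as a set of representatives in G).  Vertices are cosets, i.e. elements of V
-- up to _≈_.
record QCay : Set₁ where
  field
    V   : Set
    sub : V → V → V
    H   : V → Set
    S   : V → Set

  _≈_ : V → V → Set
  x ≈ y = H (sub x y)

  Adj : V → V → Set
  Adj x y = ∃[ s ] (S s × H (sub (sub y x) s))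

open QCay public

SACG : ∀ {m k} → Matrix m k → QCay
SACG {m} M = record
  { V   = Vecℤ m
  ; sub = λ u v i → u i - v i
  ; H   = InSpan M
  ; S   = λ s → ∃[ i ] ((∀ j → s j ≡ e i j) ⊎ (∀ j → s j ≡ - e i j))
  }

Pm : ℤ → ℤ → Set
Pm x s = (s ≡ x) ⊎ (s ≡ - x)

Zhu : ℤ → ℤ → ℤ → QCay
Zhu a b c = record
  { V   = ℤ
  ; sub = _-_
  ; H   = λ x → x ≡ 0ℤ
  ; S   = λ s → Pm a s ⊎ Pm b s ⊎ Pm c s
  }

Circ : ℕ → ℤ → ℤ → QCay
Circ n a b = record
  { V   = ℤ
  ; sub = _-_
  ; H   = λ x → (+ n) ∣ x
  ; S   = λ s → Pm a s ⊎ Pm b s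
  }

Heuberger : ℕ → ℤ → ℤ → Set
Heuberger n a b =
  (1 ℕ.≤ n) × (gcd (gcd a b) (+ n) ≡ 1ℤ) × ¬ ((+ n) ∣ a) × ¬ ((+ n) ∣ b)

InducesHom : (X Y : QCay) → (V X → V Y) → Set
InducesHom X Y f =
  (∀ x y → _≈_ X x y → _≈_ Y (f x) (f y)) ×
  (∀ x y → Adj X x y → Adj Y (f x) (f y))

-- f induces an isomorphism: the induced map on quotients is a well-defined
-- graph homomorphism, is injective and surjective (on cosets), and its
-- inverse is a graph homomorphism (f reflects adjacency).
InducesIso : (X Y : QCay) → (V X → V Y) → Set
InducesIso X Y f =
  InducesHom X Y f ×
  (∀ x y → _≈_ Y (f x) (f y) → _≈_ X x y) ×
  (∀ z → ∃[ x ] (_≈_ Y (f x) z)) ×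
  (∀ x y → Adj Y (f x) (f y) → Adj X x y)

MX : (y11 y12 y21 y22 y31 y32 : ℤ) → Matrix 3 2
MX y11 y12 y21 y22 y31 y32 zero          zero       = y11
MX y11 y12 y21 y22 y31 y32 zero          (suc zero) = y12
MX y11 y12 y21 y22 y31 y32 (suc zero)    zero       = y21
MX y11 y12 y21 y22 y31 y32 (suc zero)    (suc zero) = y22
MX y11 y12 y21 y22 y31 y32 (suc (suc zero)) zero       = y31
MX y11 y12 y21 y22 y31 y32 (suc (suc zero)) (suc zero) = y32

MY : (y11 y12 y21 y22 y31 y32 : ℤ) → Matrix 2 2
MY y11 y12 y21 y22 y31 y32 zero       zero       = y11
MY y11 y12 y21 y22 y31 y32 zero       (suc zero) = y12
MY y11 y12 y21 y22 y31 y32 (suc zero) zero       = y21 - y31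
MY y11 y12 y21 y22 y31 y32 (suc zero) (suc zero) = y22 - y32

φX : ℤ → ℤ → ℤ → Vecℤ 3 → ℤ
φX a b c v = a * v zero + b * v (suc zero) + c * v (suc (suc zero))

-- φ_Y : ℤ² → ℤ_{b+c}, e1 ↦ a, e2 ↦ b  (values in ℤ, read modulo b+c)
φY : ℤ → ℤ → Vecℤ 2 → ℤ
φY a b v = a * v zero + b * v (suc zero)

τ1 : Vecℤ 3 → Vecℤ 2
τ1 v zero       = v zero
τ1 v (suc zero) = v (suc zero) - v (suc (suc zero))

-- τ2 : ℤ → ℤ_{b+c}, reduction mod b+c (identity on representatives)
τ2 : ℤ → ℤ
τ2 x = x

{-# OPTIONS --safe #-}
-- Everything rests on the identity φX v − φY (τ1 v) = v₃ (b + c).  It gives the commuting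
-- square, and, since τ1 maps span M_X onto span M_Y with the same coefficients, it puts
-- span M_Y inside φY⁻¹((b + c)ℤ).  Conversely, if φY w = k (b + c) then (w₁, w₂ − k, −k)
-- lies in ker φX, which is span M_X because φX induces an isomorphism, and τ1 maps it to w.
-- So span M_Y = φY⁻¹((b + c)ℤ): φY is well defined and injective on cosets, and it matches
-- the generators ±e₁, ±e₂ with ±a, ±b; surjectivity is inherited from φX.  The Heuberger
-- conditions are elementary: gcd (gcd a b) (b + c) divides c, and 0 < b < b + c.
module Submission where

open import Defs
open import Data.Fin using (Fin; zero; suc)
open import Data.Nat as ℕ using (ℕ)
open import Data.Integer using (ℤ; +_; -_; _+_; _*_; _-_; 0ℤ; 1ℤ; ∣_∣)
open import Data.Integer.Divisibility using (_∣_)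
open import Data.Integer.GCD using (gcd)
open import Data.Integer.Tactic.RingSolver using (solve-∀)
open import Data.Product using (_×_; ∃-syntax; _,_)
open import Data.Sum using (_⊎_; inj₁; inj₂)
open import Function.Bundles using (_⇔_; mk⇔; Equivalence)
open import Relation.Nullary using (¬_)
open import Relation.Binary.PropositionalEquality
  using (_≡_; refl; sym; trans; cong; cong₂; subst; module ≡-Reasoning)
import Data.Integer.Divisibility.Signed as Signed
import Data.Integer.Properties as ℤ
import Data.Nat.Divisibility as ℕ
import Data.Nat.GCD as ℕ
import Data.Nat.Properties as ℕ

open Equivalence using (to; from)

gcd-gcd-+≡1 : ∀ a b c → ℕ.gcd (ℕ.gcd a b) c ≡ 1 → ℕ.gcd (ℕ.gcd a b) (b ℕ.+ c) ≡ 1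
gcd-gcd-+≡1 a b c coprime = ℕ.∣1⇒≡1 (subst (g ℕ.∣_) coprime (ℕ.gcd-greatest g∣gcd[a,b] g∣c))
  where
  g = ℕ.gcd (ℕ.gcd a b) (b ℕ.+ c)
  g∣gcd[a,b] = ℕ.gcd[m,n]∣m (ℕ.gcd a b) (b ℕ.+ c)
  g∣c : g ℕ.∣ c
  g∣c = ℕ.∣m+n∣m⇒∣n (ℕ.gcd[m,n]∣n (ℕ.gcd a b) (b ℕ.+ c))
                     (ℕ.∣-trans g∣gcd[a,b] (ℕ.gcd[m,n]∣n a b))

b+c-Heuberger : ∀ a b c → 1 ℕ.≤ b → 1 ℕ.≤ c →
  gcd (gcd (+ a) (+ b)) (+ c) ≡ + 1 → ¬ ((+ (b ℕ.+ c)) ∣ (+ a)) →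
  Heuberger (b ℕ.+ c) (+ a) (+ b)
b+c-Heuberger a b c 1≤b@(ℕ.s≤s _) 1≤c coprime b+c∤a =
  ℕ.≤-trans 1≤b (ℕ.m≤m+n b c) ,
  cong +_ (gcd-gcd-+≡1 a b c (ℤ.+-injective coprime)) ,
  b+c∤a ,
  ℕ.>⇒∤ (ℕ.m<m+n b 1≤c)

multiple⇒∣ : ∀ {k p} (t : ℤ) → p ≡ t * k → k ∣ p
multiple⇒∣ t p≡tk = Signed.∣⇒∣ᵤ (Signed.divides t p≡tk)

∣-by-multiple-difference : ∀ {k} p q (t : ℤ) → p - q ≡ t * k → k ∣ p → k ∣ q
∣-by-multiple-difference {k} p q t p-q≡tk k∣p =
  Signed.∣⇒∣ᵤ (subst (Signed._∣_ k) (sym (identity p q))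
    (Signed.∣m∣n⇒∣m-n (Signed.∣ᵤ⇒∣ {k} {p} k∣p) (Signed.divides t p-q≡tk)))
  where
  identity : ∀ p q → q ≡ p - (p - q)
  identity = solve-∀

≡0⇒∣ : ∀ k {p} → p ≡ 0ℤ → k ∣ p
≡0⇒∣ k refl = ℕ._∣0 ∣ k ∣

_·ᵥ_ : ∀ {m k} → Matrix m k → (Fin k → ℤ) → Vecℤ m
(M ·ᵥ c) i = ∑ (λ j → M i j * c j)

InSpan-resp : ∀ {m k} (M : Matrix m k) {u v : Vecℤ m} →
  (∀ i → u i ≡ v i) → InSpan M u → InSpan M v
InSpan-resp M u≗v (c , u≗Mc) = c , λ i → trans (sym (u≗v i)) (u≗Mc i)

τ1-preimage : Vecℤ 2 → ℤ → Vecℤ 3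
τ1-preimage w k zero             = w zero
τ1-preimage w k (suc zero)       = w (suc zero) - k
τ1-preimage w k (suc (suc zero)) = - k

τ1∘τ1-preimage : ∀ w k i → τ1 (τ1-preimage w k) i ≡ w i
τ1∘τ1-preimage w k zero       = refl
τ1∘τ1-preimage w k (suc zero) = identity (w (suc zero)) k
  where
  identity : ∀ w₁ k → (w₁ - k) - (- k) ≡ w₁
  identity = solve-∀

±Basis : ∀ {m} → Vecℤ m → Set
±Basis {m} s = ∃[ i ] ((∀ j → s j ≡ e i j) ⊎ (∀ j → s j ≡ - e i j))

module _ (A B : ℤ) where

  φY-cong : ∀ {u v : Vecℤ 2} → (∀ i → u i ≡ v i) → φY A B u ≡ φY A B v
  φY-cong u≗v = cong₂ (λ x y → A * x + B * y) (u≗v zero) (u≗v (suc zero))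

  φY-sub : ∀ (u v : Vecℤ 2) → φY A B (λ i → u i - v i) ≡ φY A B u - φY A B v
  φY-sub u v = identity A B (u zero) (u (suc zero)) (v zero) (v (suc zero))
    where
    identity : ∀ A B u₀ u₁ v₀ v₁ →
      A * (u₀ - v₀) + B * (u₁ - v₁) ≡ (A * u₀ + B * u₁) - (A * v₀ + B * v₁)
    identity = solve-∀

  φY-neg : ∀ (v : Vecℤ 2) → φY A B (λ i → - v i) ≡ - φY A B v
  φY-neg v = identity A B (v zero) (v (suc zero))
    where
    identity : ∀ A B v₀ v₁ → A * (- v₀) + B * (- v₁) ≡ - (A * v₀ + B * v₁)
    identity = solve-∀

  φY-e₀ : φY A B (e zero) ≡ A
  φY-e₀ = trans (cong₂ _+_ (ℤ.*-identityʳ A) (ℤ.*-zeroʳ B)) (ℤ.+-identityʳ A)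

  φY-e₁ : φY A B (e (suc zero)) ≡ B
  φY-e₁ = trans (cong₂ _+_ (ℤ.*-zeroʳ A) (ℤ.*-identityʳ B)) (ℤ.+-identityˡ B)

  φY-[-e₀] : φY A B (λ j → - e zero j) ≡ - A
  φY-[-e₀] = trans (φY-neg (e zero)) (cong -_ φY-e₀)

  φY-[-e₁] : φY A B (λ j → - e (suc zero) j) ≡ - B
  φY-[-e₁] = trans (φY-neg (e (suc zero))) (cong -_ φY-e₁)

  φY-±Basis : ∀ {s : Vecℤ 2} → ±Basis s → Pm A (φY A B s) ⊎ Pm B (φY A B s)
  φY-±Basis (zero , inj₁ s≗e)      = inj₁ (inj₁ (trans (φY-cong s≗e) φY-e₀))
  φY-±Basis (zero , inj₂ s≗-e)     = inj₁ (inj₂ (trans (φY-cong s≗-e) φY-[-e₀]))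
  φY-±Basis (suc zero , inj₁ s≗e)  = inj₂ (inj₁ (trans (φY-cong s≗e) φY-e₁))
  φY-±Basis (suc zero , inj₂ s≗-e) = inj₂ (inj₂ (trans (φY-cong s≗-e) φY-[-e₁]))

  ±Basis-lift : ∀ {t} → Pm A t ⊎ Pm B t → ∃[ s ] (±Basis s × φY A B s ≡ t)
  ±Basis-lift (inj₁ (inj₁ refl)) = e zero , (zero , inj₁ λ _ → refl) , φY-e₀
  ±Basis-lift (inj₁ (inj₂ refl)) = (λ j → - e zero j) , (zero , inj₂ λ _ → refl) , φY-[-e₀]
  ±Basis-lift (inj₂ (inj₁ refl)) = e (suc zero) , (suc zero , inj₁ λ _ → refl) , φY-e₁
  ±Basis-lift (inj₂ (inj₂ refl)) =
    (λ j → - e (suc zero) j) , (suc zero , inj₂ λ _ → refl) , φY-[-e₁]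

  φY-induces-iso : ∀ {k} (M : Matrix 2 k) (n : ℕ) →
    (∀ w → InSpan M w ⇔ (+ n) ∣ φY A B w) →
    (∀ z → ∃[ w ] ((+ n) ∣ φY A B w - z)) →
    InducesIso (SACG M) (Circ n A B) (φY A B)
  φY-induces-iso M n span⇔ surjective =
    (respects-≈ , preserves-Adj) , reflects-≈ , surjective , reflects-Adj
    where
    φY-adj : ∀ u v s → φY A B (λ i → (v i - u i) - s i) ≡ (φY A B v - φY A B u) - φY A B s
    φY-adj u v s = trans (φY-sub (λ i → v i - u i) s) (cong (_- φY A B s) (φY-sub v u))

    respects-≈ : ∀ u v → InSpan M (λ i → u i - v i) → (+ n) ∣ φY A B u - φY A B v
    respects-≈ u v h = subst ((+ n) ∣_) (φY-sub u v) (to (span⇔ _) h)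

    reflects-≈ : ∀ u v → (+ n) ∣ φY A B u - φY A B v → InSpan M (λ i → u i - v i)
    reflects-≈ u v d = from (span⇔ _) (subst ((+ n) ∣_) (sym (φY-sub u v)) d)

    preserves-Adj : ∀ u v → Adj (SACG M) u v → Adj (Circ n A B) (φY A B u) (φY A B v)
    preserves-Adj u v (s , ±s , h) =
      φY A B s , φY-±Basis ±s , subst ((+ n) ∣_) (φY-adj u v s) (to (span⇔ _) h)

    reflects-Adj : ∀ u v → Adj (Circ n A B) (φY A B u) (φY A B v) → Adj (SACG M) u v
    reflects-Adj u v (t , ±t , d) with ±Basis-lift ±t
    ... | s , ±s , refl = s , ±s , from (span⇔ _) (subst ((+ n) ∣_) (sym (φY-adj u v s)) d)

τ1-pointwise : ∀ {u v : Vecℤ 3} {w : Vecℤ 2} → (∀ i → u i ≡ v i) →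
  τ1 v zero ≡ w zero → τ1 v (suc zero) ≡ w (suc zero) → ∀ i → τ1 u i ≡ w i
τ1-pointwise u≗v eq₀ eq₁ zero       = trans (u≗v zero) eq₀
τ1-pointwise u≗v eq₀ eq₁ (suc zero) =
  trans (cong₂ _-_ (u≗v (suc zero)) (u≗v (suc (suc zero)))) eq₁

τ1-sub : ∀ (u v : Vecℤ 3) i → τ1 (λ j → u j - v j) i ≡ τ1 u i - τ1 v i
τ1-sub u v zero       = refl
τ1-sub u v (suc zero) =
  identity (u (suc zero)) (u (suc (suc zero))) (v (suc zero)) (v (suc (suc zero)))
  where
  identity : ∀ u₁ u₂ v₁ v₂ → (u₁ - v₁) - (u₂ - v₂) ≡ (u₁ - u₂) - (v₁ - v₂)
  identity = solve-∀

±Basis-τ1 : ∀ {s : Vecℤ 3} → ±Basis s → ±Basis (τ1 s)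
±Basis-τ1 (zero , inj₁ s≗e)           = zero , inj₁ (τ1-pointwise s≗e refl refl)
±Basis-τ1 (zero , inj₂ s≗-e)          = zero , inj₂ (τ1-pointwise s≗-e refl refl)
±Basis-τ1 (suc zero , inj₁ s≗e)       = suc zero , inj₁ (τ1-pointwise s≗e refl refl)
±Basis-τ1 (suc zero , inj₂ s≗-e)      = suc zero , inj₂ (τ1-pointwise s≗-e refl refl)
±Basis-τ1 (suc (suc zero) , inj₁ s≗e) = suc zero , inj₂ (τ1-pointwise s≗e refl refl)
±Basis-τ1 (suc (suc zero) , inj₂ s≗-e) = suc zero , inj₁ (τ1-pointwise s≗-e refl refl)

module _ (A B C : ℤ) where

  φX-zero : φX A B C (λ _ → 0ℤ) ≡ 0ℤ
  φX-zero = cong₂ _+_ (cong₂ _+_ (ℤ.*-zeroʳ A) (ℤ.*-zeroʳ B)) (ℤ.*-zeroʳ C)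

  φX-φY∘τ1 : ∀ (v : Vecℤ 3) → φX A B C v - φY A B (τ1 v) ≡ v (suc (suc zero)) * (B + C)
  φX-φY∘τ1 v = identity A B C (v zero) (v (suc zero)) (v (suc (suc zero)))
    where
    identity : ∀ A B C v₀ v₁ v₂ →
      (A * v₀ + B * v₁ + C * v₂) - (A * v₀ + B * (v₁ - v₂)) ≡ v₂ * (B + C)
    identity = solve-∀

  kernel-of-induced-iso : ∀ {k} (M : Matrix 3 k) →
    InducesIso (SACG M) (Zhu A B C) (φX A B C) → ∀ x → InSpan M x ⇔ φX A B C x ≡ 0ℤ
  kernel-of-induced-iso M ((respects-≈ , _) , reflects-≈ , _) x = mk⇔
    (λ x∈M → trans (sym φX[x]-φX[0])
      (respects-≈ x 0v (InSpan-resp M (λ i → sym (ℤ.+-identityʳ (x i))) x∈M)))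
    (λ φX[x]≡0 → InSpan-resp M (λ i → ℤ.+-identityʳ (x i))
      (reflects-≈ x 0v (trans φX[x]-φX[0] φX[x]≡0)))
    where
    0v : Vecℤ 3
    0v _ = 0ℤ
    φX[x]-φX[0] : φX A B C x - φX A B C 0v ≡ φX A B C x
    φX[x]-φX[0] = trans (cong (λ t → φX A B C x - t) φX-zero) (ℤ.+-identityʳ _)

  φX-τ1-preimage : ∀ w k → φX A B C (τ1-preimage w k) ≡ φY A B w - k * (B + C)
  φX-τ1-preimage w k = identity A B C (w zero) (w (suc zero)) k
    where
    identity : ∀ A B C w₀ w₁ k →
      A * w₀ + B * (w₁ - k) + C * (- k) ≡ (A * w₀ + B * w₁) - k * (B + C)
    identity = solve-∀

  φY-surjective : (∀ z → ∃[ x ] (φX A B C x - z ≡ 0ℤ)) →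
    ∀ z → ∃[ w ] ((B + C) ∣ φY A B w - z)
  φY-surjective φX-surjective z with φX-surjective z
  ... | x , φX[x]-z≡0 = τ1 x ,
    ∣-by-multiple-difference (φX A B C x - z) (φY A B (τ1 x) - z) (x (suc (suc zero)))
      (trans (identity (φX A B C x) (φY A B (τ1 x)) z) (φX-φY∘τ1 x))
      (≡0⇒∣ (B + C) φX[x]-z≡0)
    where
    identity : ∀ p q z → (p - z) - (q - z) ≡ p - q
    identity = solve-∀

τ2-induces-hom : ∀ A b c → InducesHom (Zhu A (+ b) (+ c)) (Circ (b ℕ.+ c) A (+ b)) τ2
τ2-induces-hom A b c = (λ x y → ≡0⇒∣ (+ (b ℕ.+ c))) , preserves-Adj
  where
  B = + b
  C = + c
  preserves-Adj : ∀ x y → Adj (Zhu A B C) x y → Adj (Circ (b ℕ.+ c) A B) (τ2 x) (τ2 y)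
  preserves-Adj x y (s , inj₁ ±a , h)        = s , inj₁ ±a , ≡0⇒∣ (B + C) h
  preserves-Adj x y (s , inj₂ (inj₁ ±b) , h) = s , inj₂ ±b , ≡0⇒∣ (B + C) h
  preserves-Adj x y (s , inj₂ (inj₂ (inj₁ refl)) , h) =
    - B , inj₂ (inj₂ refl) ,
    ∣-by-multiple-difference ((y - x) - C) ((y - x) - - B) (- 1ℤ) (identity (y - x) B C)
      (≡0⇒∣ (B + C) h)
    where
    identity : ∀ d B C → (d - C) - (d - - B) ≡ - 1ℤ * (B + C)
    identity = solve-∀
  preserves-Adj x y (s , inj₂ (inj₂ (inj₂ refl)) , h) =
    B , inj₂ (inj₁ refl) ,
    ∣-by-multiple-difference ((y - x) - - C) ((y - x) - B) 1ℤ (identity (y - x) B C)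
      (≡0⇒∣ (B + C) h)
    where
    identity : ∀ d B C → (d - - C) - (d - B) ≡ 1ℤ * (B + C)
    identity = solve-∀

module _ (y₁₁ y₁₂ y₂₁ y₂₂ y₃₁ y₃₂ : ℤ) where
  private
    Mx = MX y₁₁ y₁₂ y₂₁ y₂₂ y₃₁ y₃₂
    My = MY y₁₁ y₁₂ y₂₁ y₂₂ y₃₁ y₃₂

  τ1∘Mx : ∀ c i → τ1 (Mx ·ᵥ c) i ≡ (My ·ᵥ c) i
  τ1∘Mx c zero       = refl
  τ1∘Mx c (suc zero) = identity y₂₁ y₂₂ y₃₁ y₃₂ (c zero) (c (suc zero))
    where
    identity : ∀ y₂₁ y₂₂ y₃₁ y₃₂ c₀ c₁ →
      (y₂₁ * c₀ + (y₂₂ * c₁ + 0ℤ)) - (y₃₁ * c₀ + (y₃₂ * c₁ + 0ℤ))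
        ≡ (y₂₁ - y₃₁) * c₀ + ((y₂₂ - y₃₂) * c₁ + 0ℤ)
    identity = solve-∀

  τ1-span : ∀ {v} → InSpan Mx v → InSpan My (τ1 v)
  τ1-span (c , v≗Mxc) = c , τ1-pointwise v≗Mxc refl (τ1∘Mx c (suc zero))

  τ1-induces-hom : InducesHom (SACG Mx) (SACG My) τ1
  τ1-induces-hom =
    (λ x y x≈y → InSpan-resp My (τ1-sub x y) (τ1-span x≈y)) ,
    λ x y (s , ±s , h) → τ1 s , ±Basis-τ1 ±s , InSpan-resp My (τ1-adj x y s) (τ1-span h)
    where
    τ1-adj : ∀ x y s i → τ1 (λ j → (y j - x j) - s j) i ≡ (τ1 y i - τ1 x i) - τ1 s i
    τ1-adj x y s i = trans (τ1-sub (λ j → y j - x j) s i) (cong (_- τ1 s i) (τ1-sub y x i))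

  InSpan-MY⇔∣φY : ∀ A B C → (∀ x → InSpan Mx x ⇔ φX A B C x ≡ 0ℤ) →
    ∀ w → InSpan My w ⇔ (B + C) ∣ φY A B w
  InSpan-MY⇔∣φY A B C kernel w = mk⇔ divides divides⇒InSpan
    where
    divides : InSpan My w → (B + C) ∣ φY A B w
    divides (c , w≗Myc) = subst ((B + C) ∣_) (φY-cong A B τ1[x]≗w)
      (∣-by-multiple-difference (φX A B C x) (φY A B (τ1 x)) (x (suc (suc zero)))
        (φX-φY∘τ1 A B C x) (≡0⇒∣ (B + C) (to (kernel x) (c , λ _ → refl))))
      where
      x = Mx ·ᵥ c
      τ1[x]≗w : ∀ i → τ1 x i ≡ w i
      τ1[x]≗w i = trans (τ1∘Mx c i) (sym (w≗Myc i))
    divides⇒InSpan : (B + C) ∣ φY A B w → InSpan My w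
    divides⇒InSpan d with Signed.∣ᵤ⇒∣ {B + C} {φY A B w} d
    ... | Signed.divides k φY[w]≡k[B+C] =
      InSpan-resp My (τ1∘τ1-preimage w k) (τ1-span (from (kernel x) φX[x]≡0))
      where
      x = τ1-preimage w k
      φX[x]≡0 : φX A B C x ≡ 0ℤ
      φX[x]≡0 = begin
        φX A B C x                ≡⟨ φX-τ1-preimage A B C w k ⟩
        φY A B w - k * (B + C)    ≡⟨ cong (_- k * (B + C)) φY[w]≡k[B+C] ⟩
        k * (B + C) - k * (B + C) ≡⟨ ℤ.+-inverseʳ (k * (B + C)) ⟩
        0ℤ                        ∎
        where open ≡-Reasoning

lemma2p2 : (a b c : ℕ) → 1 ℕ.≤ a → 1 ℕ.≤ b → 1 ℕ.≤ c →
    gcd (gcd (+ a) (+ b)) (+ c) ≡ + 1 → ¬ ((+ (b ℕ.+ c)) ∣ (+ a)) →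
    Heuberger (b ℕ.+ c) (+ a) (+ b) ×
    ((y11 y12 y21 y22 y31 y32 : ℤ) →
      InducesIso (SACG (MX y11 y12 y21 y22 y31 y32)) (Zhu (+ a) (+ b) (+ c)) (φX (+ a) (+ b) (+ c)) →
      InducesIso (SACG (MY y11 y12 y21 y22 y31 y32)) (Circ (b ℕ.+ c) (+ a) (+ b)) (φY (+ a) (+ b)) ×
      InducesHom (SACG (MX y11 y12 y21 y22 y31 y32)) (SACG (MY y11 y12 y21 y22 y31 y32)) τ1 ×
      InducesHom (Zhu (+ a) (+ b) (+ c)) (Circ (b ℕ.+ c) (+ a) (+ b)) τ2 ×
      (∀ v → _≈_ (Circ (b ℕ.+ c) (+ a) (+ b)) (τ2 (φX (+ a) (+ b) (+ c) v)) (φY (+ a) (+ b) (τ1 v))))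
lemma2p2 a b c _ 1≤b 1≤c coprime b+c∤a =
  b+c-Heuberger a b c 1≤b 1≤c coprime b+c∤a ,
  λ y₁₁ y₁₂ y₂₁ y₂₂ y₃₁ y₃₂ X≅Zhu@(_ , _ , φX-surjective , _) →
    φY-induces-iso A B (MY y₁₁ y₁₂ y₂₁ y₂₂ y₃₁ y₃₂) (b ℕ.+ c)
      (InSpan-MY⇔∣φY y₁₁ y₁₂ y₂₁ y₂₂ y₃₁ y₃₂ A B C
        (kernel-of-induced-iso A B C (MX y₁₁ y₁₂ y₂₁ y₂₂ y₃₁ y₃₂) X≅Zhu))
      (φY-surjective A B C φX-surjective) ,
    τ1-induces-hom y₁₁ y₁₂ y₂₁ y₂₂ y₃₁ y₃₂ ,
    τ2-induces-hom A b c ,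
    λ v → multiple⇒∣ (v (suc (suc zero))) (φX-φY∘τ1 A B C v)
  where
  A = + a
  B = + b
  C = + c
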